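{- For every tree $T=(V,E)$ we have $\mathrm{LMC}(T)\subseteq Q'(T)\subseteq Q(T)$.
   Context: For a tree $T=(V,E)$ and distinct $u,v\in V$, let $P_{uv}=(V_{uv},E_{uv})$ be the unique $uv$-path in $T$ and $d(u,v)$ its length. If $d(u,v)\ge 2$, let $\vec u(v)$ denote the neighbor of $u$ on $P_{uv}$ (the first node of $P_{uv}$ different from $u$ and $v$). Edges of $T$ are identified with pairs in $\binom{V}{2}$. A decomposition of $T$ is a partition of $V$ each of whose blocks induces a connected subtree; for such a decomposition $\Pi$, its lifted multicut is the set of pairs $uv\in\binom{V}{2}$ with $u,v$ in distinct blocks. $\mathrm{LMC}(T)\subseteq\mathbb{R}^{\binom{V}{2}}$ is the convex hull of the characteristic vectors of these lifted multicuts over all decompositions of $T$. $Q(T)$ is the set of $x\in[0,1]^{\binom{V}{2}}$ with $x_{uv}\le\sum_{e\in E_{uv}}x_e$ and $x_e\le x_{uv}$ for all $u,v$ with $d(u,v)\ge2$ and all $e\in E_{uv}$. $Q'(T)$ is the set of $x\in[0,1]^{\binom{V}{2}}$ with $x_{uv}\le x_{u,\vec u(v)}+x_{\vec u(v),v}$ and $x_{\vec u(v),v}\le x_{uv}$ for all $u,v\in V$ with $d(u,v)\ge2$.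
   Formalization: The vectors x have rational coordinates, and the convex-combination weights defining $\mathrm{LMC}(T)$ are rational, in place of real ones. -}

module Defs where

open import Data.Nat as ℕ using (ℕ; zero; suc)
open import Data.Fin using (Fin; _≟_)
open import Data.List using (List; []; _∷_)
open import Data.List.Relation.Unary.All using (All)
open import Data.List.Relation.Unary.Unique.Propositional using (Unique)
open import Data.Product using (Σ; _×_; _,_; proj₁; proj₂)
open import Data.Rational using (ℚ; 0ℚ; 1ℚ; _+_; _*_; _≤_)
open import Relation.Nullary using (¬_; yes; no)
open import Relation.Binary.PropositionalEquality using (_≡_; _≢_)

-- Walks in a graph on vertex set Fin n given by an adjacency relation A.
-- A walk is recorded by its vertex sequence u = w₀, w₁, …, w_k = v.
data Path {n : ℕ} (A : Fin n → Fin n → Set) : Fin n → Fin n → Set where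
  stop : ∀ u → Path A u u
  step : ∀ u {w v} → A u w → Path A w v → Path A u v

module _ {n : ℕ} {A : Fin n → Fin n → Set} where

  verts : ∀ {u v} → Path A u v → List (Fin n)
  verts (stop u) = u ∷ []
  verts (step u _ p) = u ∷ verts p

  len : ∀ {u v} → Path A u v → ℕ
  len (stop _) = 0
  len (step _ _ p) = suc (len p)

  Simple : ∀ {u v} → Path A u v → Set
  Simple p = Unique (verts p)

  data EdgeOf : ∀ {u v} → Fin n → Fin n → Path A u v → Set where
    here  : ∀ {u w v} {e : A u w} {p : Path A w v} → EdgeOf u w (step u e p)
    there : ∀ {u w v a b} {e : A u w} {p : Path A w v} →
            EdgeOf a b p → EdgeOf a b (step u e p)

  edgeSum : (Fin n → Fin n → ℚ) → ∀ {u v} → Path A u v → ℚ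
  edgeSum x (stop _) = 0ℚ
  edgeSum x (step u {w} _ p) = x u w + edgeSum x p

record Tree (n : ℕ) : Set₁ where
  field
    Adj        : Fin n → Fin n → Set
    Adj-sym    : ∀ {u v} → Adj u v → Adj v u
    Adj-irrefl : ∀ {u} → ¬ Adj u u
    connected  : ∀ u v → Σ (Path Adj u v) Simple
    uniquePath : ∀ {u v} (p q : Path Adj u v) → Simple p → Simple q →
                 verts p ≡ verts q

-- Vectors in ℚ^{(V choose 2)} are represented by functions x : V → V → ℚ;
-- only off-diagonal values matter, and symmetry is required where relevant.
Vect : ℕ → Set
Vect n = Fin n → Fin n → ℚ

module _ {n : ℕ} (T : Tree n) where
  open Tree T

  -- A decomposition of T, given by a block labelling f : V → V
  -- (u, v in the same block iff f u ≡ f v); every block must induce a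
  -- connected subgraph: any two vertices of a block are joined by a path
  -- inside the block.
  Decomposition : Set
  Decomposition =
    Σ (Fin n → Fin n) λ f →
      ∀ u v → f u ≡ f v → Σ (Path Adj u v) λ p → All (λ w → f w ≡ f u) (verts p)

  χ : Decomposition → Vect n
  χ (f , _) u v with f u ≟ f v
  ... | yes _ = 0ℚ
  ... | no  _ = 1ℚ

  weightSum : List (ℚ × Decomposition) → ℚ
  weightSum [] = 0ℚ
  weightSum ((λ₀ , _) ∷ cs) = λ₀ + weightSum cs

  combo : List (ℚ × Decomposition) → Vect n
  combo [] u v = 0ℚ
  combo ((λ₀ , Π) ∷ cs) u v = λ₀ * χ Π u v + combo cs u v

  InLMC : Vect n → Set
  InLMC x =
    Σ (List (ℚ × Decomposition)) λ cs →
      All (λ c → 0ℚ ≤ proj₁ c) cs × weightSum cs ≡ 1ℚ ×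
      (∀ u v → u ≢ v → x u v ≡ combo cs u v)

  InCube : Vect n → Set
  InCube x = (∀ u v → x u v ≡ x v u) × (∀ u v → u ≢ v → 0ℚ ≤ x u v × x u v ≤ 1ℚ)

  InQ : Vect n → Set
  InQ x = InCube x ×
    (∀ u v (p : Path Adj u v) → Simple p → 2 ℕ.≤ len p →
       (x u v ≤ edgeSum x p) × (∀ a b → EdgeOf a b p → x a b ≤ x u v))

  -- Q'(T): for the path P_uv = u, w, …, v (so w = u→(v))
  InQ' : Vect n → Set
  InQ' x = InCube x ×
    (∀ u w v (e : Adj u w) (p : Path Adj w v) → Simple (step u e p) → 1 ℕ.≤ len p →
       (x u v ≤ x u w + x w v) × (x w v ≤ x u v))

{-# OPTIONS --safe #-}
module Submission where

-- A lifted multicut is the pull-back of the discrete metric along the block labelling, so it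
-- satisfies the triangle inequality; and a block containing u and v contains the whole path
-- P_uv, since the block is connected and paths in a tree are unique, so cutting u→(v) from v
-- forces cutting u from v. Both inequalities survive convex combinations. Conversely, the
-- inequality x_uv ≤ x_{u,u→(v)} + x_{u→(v),v} unfolds along P_uv to x_uv ≤ Σ_{e ∈ E_uv} x_e,
-- and x_{u→(v),v} ≤ x_uv, applied along P_uv and along its reverse, bounds every x_e by x_uv.

open import Defs
open import Data.Nat using (ℕ)
open import Data.Product using (_×_)

open import Data.Nat as ℕ using (s≤s; z≤n)
import Data.Nat.Properties as ℕₚ
open import Data.Fin using (Fin; _≟_)
open import Data.Fin.Properties using (≡-setoid)
open import Data.List as List using (List; []; _∷_; _∷ʳ_)
open import Data.List.Properties using (unfold-reverse)
open import Data.List.Relation.Unary.All as All using (All; []; _∷_)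
open import Data.List.Relation.Unary.All.Properties using (¬Any⇒All¬)
open import Data.List.Relation.Unary.Any using (here; there)
open import Data.List.Relation.Unary.AllPairs using ([]; _∷_)
open import Data.List.Relation.Unary.Unique.Propositional using (Unique)
open import Data.List.Membership.Propositional using (_∈_)
import Data.List.Membership.DecPropositional as DecMembership
open import Data.List.Relation.Binary.Subset.Propositional using (_⊆_)
open import Data.List.Relation.Binary.Subset.Propositional.Properties
  using (⊆-refl; ⊆-reflexive; xs⊆x∷xs; ∷⁺ʳ)
import Data.List.Relation.Binary.Permutation.Setoid as PermutationRelation
import Data.List.Relation.Binary.Permutation.Setoid.Properties as Permutation
open import Data.Product using (Σ; _,_; proj₁; proj₂)
open import Data.Rational using (ℚ; 0ℚ; 1ℚ; _+_; _*_; _≤_; _≤?_; nonNegative)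
open import Data.Rational.Properties
  using (≤-refl; ≤-trans; ≤-reflexive; +-mono-≤; +-monoʳ-≤; +-identityʳ;
         *-monoˡ-≤-nonNeg; *-distribˡ-+; *-zeroʳ; *-identityʳ; +-0-commutativeMonoid;
         module ≤-Reasoning)
open import Algebra.Bundles using (CommutativeMonoid)
open import Algebra.Properties.CommutativeSemigroup
  (CommutativeMonoid.commutativeSemigroup +-0-commutativeMonoid) using (interchange)
open import Function using (_∘_)
open import Relation.Nullary using (yes; no; contradiction)
open import Relation.Nullary.Decidable using (True; toWitness)
open import Relation.Binary.PropositionalEquality
  using (_≡_; _≢_; refl; sym; trans; cong; cong₂; subst)

≤-byEvaluation : ∀ {p q} {p≤?q : True (p ≤? q)} → p ≤ q
≤-byEvaluation {p≤?q = p≤?q} = toWitness p≤?q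

*-monoˡ-≤-byNonNeg : ∀ {l p q} → 0ℚ ≤ l → p ≤ q → l * p ≤ l * q
*-monoˡ-≤-byNonNeg {l} 0≤l = *-monoˡ-≤-nonNeg l {{nonNegative 0≤l}}

module _ {n : ℕ} {A : Fin n → Fin n → Set} where
  open DecMembership (_≟_ {n}) using (_∈?_)

  head∈verts : ∀ {u v} (p : Path A u v) → u ∈ verts p
  head∈verts (stop u) = here refl
  head∈verts (step u _ p) = here refl

  last∈verts : ∀ {u v} (p : Path A u v) → v ∈ verts p
  last∈verts (stop u) = here refl
  last∈verts (step u _ p) = there (last∈verts p)

  simple⇒ends-distinct : ∀ {u v} (p : Path A u v) → Simple p → 1 ℕ.≤ len p → u ≢ v
  simple⇒ends-distinct (step u _ p) (u∉p ∷ _) _ = All.lookup u∉p (last∈verts p)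

  snoc : ∀ {u w v} → Path A u w → A w v → Path A u v
  snoc (stop u) e = step u e (stop _)
  snoc (step u e' p) e = step u e' (snoc p e)

  verts-snoc : ∀ {u w v} (p : Path A u w) (e : A w v) → verts (snoc p e) ≡ verts p ∷ʳ v
  verts-snoc (stop u) e = refl
  verts-snoc (step u e' p) e = cong (u ∷_) (verts-snoc p e)

  1≤len-snoc : ∀ {u w v} (p : Path A u w) (e : A w v) → 1 ℕ.≤ len (snoc p e)
  1≤len-snoc (stop u) e = s≤s z≤n
  1≤len-snoc (step u e' p) e = s≤s z≤n

  suffixFrom : ∀ {z u v} (p : Path A z v) → u ∈ verts p → Simple p →
               Σ (Path A u v) λ s → Simple s × verts s ⊆ verts p
  suffixFrom (stop z) (here refl) p-simple = stop z , p-simple , ⊆-refl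
  suffixFrom (step z e p) (here refl) p-simple = step z e p , p-simple , ⊆-refl
  suffixFrom (step z e p) (there u∈p) (_ ∷ p-simple) with suffixFrom p u∈p p-simple
  ... | s , s-simple , s⊆p = s , s-simple , xs⊆x∷xs _ z ∘ s⊆p

  simplify : ∀ {u v} (q : Path A u v) → Σ (Path A u v) λ p → Simple p × verts p ⊆ verts q
  simplify (stop u) = stop u , [] ∷ [] , ⊆-refl
  simplify (step u e q) with simplify q
  ... | p , p-simple , p⊆q with u ∈? verts p
  ...   | yes u∈p = let s , s-simple , s⊆p = suffixFrom p u∈p p-simple
                    in s , s-simple , xs⊆x∷xs _ u ∘ p⊆q ∘ s⊆p
  ...   | no u∉p = step u e p , ¬Any⇒All¬ (verts p) u∉p ∷ p-simple , ∷⁺ʳ u p⊆q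

  module _ (A-sym : ∀ {u v} → A u v → A v u) where

    reverse : ∀ {u v} → Path A u v → Path A v u
    reverse (stop u) = stop u
    reverse (step u e p) = snoc (reverse p) (A-sym e)

    verts-reverse : ∀ {u v} (p : Path A u v) → verts (reverse p) ≡ List.reverse (verts p)
    verts-reverse (stop u) = refl
    verts-reverse (step u e p) = trans (verts-snoc (reverse p) (A-sym e))
      (trans (cong (_∷ʳ u) (verts-reverse p)) (sym (unfold-reverse u (verts p))))

    reverse-simple : ∀ {u v} (p : Path A u v) → Simple p → Simple (reverse p)
    reverse-simple p p-simple = subst Unique (sym (verts-reverse p))
      (Unique-resp-↭ (↭-sym (↭-reverse (verts p))) p-simple)
      where
      open Permutation (≡-setoid n) using (Unique-resp-↭; ↭-reverse)
      open PermutationRelation (≡-setoid n) using (↭-sym)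

module _ {n : ℕ} (T : Tree n) where
  open Tree T

  simplePath⊆walk : ∀ {u v} {p : Path Adj u v} → Simple p → (q : Path Adj u v) → verts p ⊆ verts q
  simplePath⊆walk {p = p} p-simple q with simplify q
  ... | c , c-simple , c⊆q = c⊆q ∘ ⊆-reflexive (uniquePath p c p-simple c-simple)

  SameBlock : Decomposition T → Fin n → Fin n → Set
  SameBlock Π u v = proj₁ Π u ≡ proj₁ Π v

  sameBlock-path : ∀ Π {u v} → SameBlock Π u v → (p : Path Adj u v) → Simple p →
                   ∀ {y} → y ∈ verts p → SameBlock Π y u
  sameBlock-path (f , blocks-connected) {u} {v} fu≡fv p p-simple y∈p
    with blocks-connected u v fu≡fv
  ... | q , q-inside = All.lookup q-inside (simplePath⊆walk p-simple q y∈p)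

  χ-sym : ∀ Π u v → χ T Π u v ≡ χ T Π v u
  χ-sym (f , _) u v with f u ≟ f v | f v ≟ f u
  ... | yes _     | yes _     = refl
  ... | no _      | no _      = refl
  ... | yes fu≡fv | no fv≢fu  = contradiction (sym fu≡fv) fv≢fu
  ... | no fu≢fv  | yes fv≡fu = contradiction (sym fv≡fu) fu≢fv

  χ-nonNeg : ∀ Π u v → 0ℚ ≤ χ T Π u v
  χ-nonNeg (f , _) u v with f u ≟ f v
  ... | yes _ = ≤-byEvaluation
  ... | no _  = ≤-byEvaluation

  χ-≤1 : ∀ Π u v → χ T Π u v ≤ 1ℚ
  χ-≤1 (f , _) u v with f u ≟ f v
  ... | yes _ = ≤-byEvaluation
  ... | no _  = ≤-byEvaluation

  χ-triangle : ∀ Π u w v → χ T Π u v ≤ χ T Π u w + χ T Π w v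
  χ-triangle (f , _) u w v with f u ≟ f v | f u ≟ f w | f w ≟ f v
  ... | yes _    | yes _     | yes _     = ≤-byEvaluation
  ... | yes _    | yes _     | no _      = ≤-byEvaluation
  ... | yes _    | no _      | yes _     = ≤-byEvaluation
  ... | yes _    | no _      | no _      = ≤-byEvaluation
  ... | no fu≢fv | yes fu≡fw | yes fw≡fv = contradiction (trans fu≡fw fw≡fv) fu≢fv
  ... | no _     | yes _     | no _      = ≤-byEvaluation
  ... | no _     | no _      | yes _     = ≤-byEvaluation
  ... | no _     | no _      | no _      = ≤-byEvaluation

  χ-mono : ∀ Π a b c d → (SameBlock Π a b → SameBlock Π c d) → χ T Π c d ≤ χ T Π a b
  χ-mono (f , _) a b c d ab⇒cd with f c ≟ f d | f a ≟ f b
  ... | yes _     | yes _     = ≤-byEvaluation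
  ... | yes _     | no _      = ≤-byEvaluation
  ... | no fc≢fd  | yes fa≡fb = contradiction (ab⇒cd fa≡fb) fc≢fd
  ... | no _      | no _      = ≤-byEvaluation

  NonNegWeights : List (ℚ × Decomposition T) → Set
  NonNegWeights = All (λ c → 0ℚ ≤ proj₁ c)

  combo-sym : ∀ cs u v → combo T cs u v ≡ combo T cs v u
  combo-sym [] u v = refl
  combo-sym ((l , Π) ∷ cs) u v = cong₂ _+_ (cong (l *_) (χ-sym Π u v)) (combo-sym cs u v)

  combo-nonNeg : ∀ cs → NonNegWeights cs → ∀ u v → 0ℚ ≤ combo T cs u v
  combo-nonNeg [] [] u v = ≤-refl
  combo-nonNeg ((l , Π) ∷ cs) (0≤l ∷ ws) u v = begin
    0ℚ                              ≡⟨ +-identityʳ 0ℚ ⟨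
    0ℚ + 0ℚ                         ≡⟨ cong (_+ 0ℚ) (*-zeroʳ l) ⟨
    l * 0ℚ + 0ℚ                     ≤⟨ +-mono-≤ (*-monoˡ-≤-byNonNeg 0≤l (χ-nonNeg Π u v))
                                                (combo-nonNeg cs ws u v) ⟩
    l * χ T Π u v + combo T cs u v  ∎
    where open ≤-Reasoning

  combo-≤-weightSum : ∀ cs → NonNegWeights cs → ∀ u v → combo T cs u v ≤ weightSum T cs
  combo-≤-weightSum [] [] u v = ≤-refl
  combo-≤-weightSum ((l , Π) ∷ cs) (0≤l ∷ ws) u v = begin
    l * χ T Π u v + combo T cs u v  ≤⟨ +-mono-≤ (*-monoˡ-≤-byNonNeg 0≤l (χ-≤1 Π u v))
                                                (combo-≤-weightSum cs ws u v) ⟩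
    l * 1ℚ + weightSum T cs         ≡⟨ cong (_+ weightSum T cs) (*-identityʳ l) ⟩
    l + weightSum T cs              ∎
    where open ≤-Reasoning

  combo-mono : ∀ cs → NonNegWeights cs → ∀ {a b c d} →
               (∀ Π → χ T Π c d ≤ χ T Π a b) → combo T cs c d ≤ combo T cs a b
  combo-mono [] [] _ = ≤-refl
  combo-mono ((l , Π) ∷ cs) (0≤l ∷ ws) χ-cd≤ab =
    +-mono-≤ (*-monoˡ-≤-byNonNeg 0≤l (χ-cd≤ab Π)) (combo-mono cs ws χ-cd≤ab)

  combo-subadditive : ∀ cs → NonNegWeights cs → ∀ {a b c d e f} →
                      (∀ Π → χ T Π a b ≤ χ T Π c d + χ T Π e f) →
                      combo T cs a b ≤ combo T cs c d + combo T cs e f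
  combo-subadditive [] [] _ = ≤-byEvaluation
  combo-subadditive ((l , Π) ∷ cs) (0≤l ∷ ws) {a} {b} {c} {d} {e} {f} χ-ab≤cd+ef = begin
    l * χ T Π a b + combo T cs a b
      ≤⟨ +-mono-≤ (*-monoˡ-≤-byNonNeg 0≤l (χ-ab≤cd+ef Π)) (combo-subadditive cs ws χ-ab≤cd+ef) ⟩
    l * (χ T Π c d + χ T Π e f) + (combo T cs c d + combo T cs e f)
      ≡⟨ cong (_+ _) (*-distribˡ-+ l (χ T Π c d) (χ T Π e f)) ⟩
    (l * χ T Π c d + l * χ T Π e f) + (combo T cs c d + combo T cs e f)
      ≡⟨ interchange (l * χ T Π c d) (l * χ T Π e f) (combo T cs c d) (combo T cs e f) ⟩
    (l * χ T Π c d + combo T cs c d) + (l * χ T Π e f + combo T cs e f)  ∎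
    where open ≤-Reasoning

  Q'-Inequalities : Vect n → Set
  Q'-Inequalities x = ∀ u w v (e : Adj u w) (p : Path Adj w v) → Simple (step u e p) →
    1 ℕ.≤ len p → (x u v ≤ x u w + x w v) × (x w v ≤ x u v)

  LMC⊆Q' : ∀ x → InLMC T x → InQ' T x
  LMC⊆Q' x (cs , ws , Σws≡1 , x≡combo) = (x-sym , x-bounds) , x-Q'
    where
    x-sym : ∀ u v → x u v ≡ x v u
    x-sym u v with u ≟ v
    ... | yes refl = refl
    ... | no u≢v = trans (x≡combo u v u≢v)
                    (trans (combo-sym cs u v) (sym (x≡combo v u (u≢v ∘ sym))))

    x-bounds : ∀ u v → u ≢ v → (0ℚ ≤ x u v) × (x u v ≤ 1ℚ)
    x-bounds u v u≢v rewrite x≡combo u v u≢v | sym Σws≡1 =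
      combo-nonNeg cs ws u v , combo-≤-weightSum cs ws u v

    x-Q' : Q'-Inequalities x
    x-Q' u w v e p up-simple@(u∉p ∷ p-simple) 1≤|p|
      rewrite x≡combo u v (simple⇒ends-distinct (step u e p) up-simple (s≤s z≤n))
            | x≡combo u w (All.lookup u∉p (head∈verts p))
            | x≡combo w v (simple⇒ends-distinct p p-simple 1≤|p|) =
      combo-subadditive cs ws (λ Π → χ-triangle Π u w v) ,
      combo-mono cs ws (λ Π → χ-mono Π u v w v (λ u∼v →
        trans (sameBlock-path Π u∼v (step u e p) up-simple (there (head∈verts p))) u∼v))

  module Q'-Consequences (x : Vect n) (x-sym : ∀ u v → x u v ≡ x v u) (x-Q' : Q'-Inequalities x)
    where

    lastEdge≤ends : ∀ {v b a} (r : Path Adj v b) (e : Adj b a) → Simple (snoc r e) → x b a ≤ x v a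
    lastEdge≤ends (stop v) e _ = ≤-refl
    lastEdge≤ends (step v e′ r) e re-simple@(_ ∷ r-simple) =
      ≤-trans (lastEdge≤ends r e r-simple) (proj₂ (x-Q' v _ _ e′ (snoc r e) re-simple (1≤len-snoc r e)))

    firstEdge≤ends : ∀ {a b v} (e : Adj a b) (s : Path Adj b v) → Simple (step a e s) → x a b ≤ x a v
    firstEdge≤ends {a} {b} {v} e s es-simple = begin
      x a b  ≡⟨ x-sym a b ⟩
      x b a  ≤⟨ lastEdge≤ends (reverse Adj-sym s) (Adj-sym e) (reverse-simple Adj-sym (step a e s) es-simple) ⟩
      x v a  ≡⟨ x-sym v a ⟩
      x a v  ∎
      where open ≤-Reasoning

    edge≤ends : ∀ {u v a b} (p : Path Adj u v) → Simple p → EdgeOf a b p → x a b ≤ x u v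
    edge≤ends (step u e p) p-simple here = firstEdge≤ends e p p-simple
    edge≤ends (step u e p@(step _ _ _)) ep-simple@(_ ∷ p-simple) (there ab∈p) =
      ≤-trans (edge≤ends p p-simple ab∈p) (proj₂ (x-Q' u _ _ e p ep-simple (s≤s z≤n)))

    ends≤edgeSum : ∀ {u v} (p : Path Adj u v) → Simple p → 1 ℕ.≤ len p → x u v ≤ edgeSum x p
    ends≤edgeSum (step u e (stop v)) _ _ = ≤-reflexive (sym (+-identityʳ (x u v)))
    ends≤edgeSum (step u {w} e p@(step _ _ _)) ep-simple@(_ ∷ p-simple) _ =
      ≤-trans (proj₁ (x-Q' u _ _ e p ep-simple (s≤s z≤n)))
              (+-monoʳ-≤ (x u w) (ends≤edgeSum p p-simple (s≤s z≤n)))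

  Q'⊆Q : ∀ x → InQ' T x → InQ T x
  Q'⊆Q x (x-cube@(x-sym , _) , x-Q') = x-cube , λ u v p p-simple 2≤|p| →
    ends≤edgeSum p p-simple (ℕₚ.<⇒≤ 2≤|p|) , λ a b ab∈p → edge≤ends p p-simple ab∈p
    where open Q'-Consequences x x-sym x-Q'

proposition6p5 : (n : ℕ) (T : Tree n) (x : Vect n) →
    (InLMC T x → InQ' T x) × (InQ' T x → InQ T x)
proposition6p5 n T x = LMC⊆Q' T x , Q'⊆Q T x
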